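{- Every elementary lattice-regular two-dimensional convex lattice polygon in $\mathbb R^2$ is lattice-congruent to one of the following six polygons: (1) the triangle with vertices $(0,0),(1,0),(0,1)$; (2) the triangle with vertices $(0,0),(1,0),(2,3)$; (3) the square with vertices $(0,0),(1,0),(0,1),(1,1)$; (4) the parallelogram with vertices $(0,0),(1,0),(1,2),(2,2)$; (5) the hexagon with vertices $\pm(1,0),\pm(0,1),\pm(1,-1)$; (6) the hexagon with vertices $\pm(2,1),\pm(1,2),\pm(1,-1)$.
   Context: The lattice is $\mathbb Z^2\subset\mathbb R^2$. A lattice polygon has all vertices in $\mathbb Z^2$. A lattice-affine transformation is an affine bijection of $\mathbb R^2$ mapping $\mathbb Z^2$ onto itself; two lattice polygons are lattice-congruent if such a map takes one onto the other. A face-flag of a polygon is a pair (edge, endpoint of that edge) together with the polygon itself; a polygon is lattice-regular if for any two face-flags some lattice-affine transformation maps the polygon onto itself and one flag onto the other. If $Q$ has vertices $O+\bar v_i$ ($O$ the origin), its $t$-multiple is the polygon with vertices $O+t\bar v_i$. A lattice polygon $P$ is elementary if for no integer $t>1$ and no lattice polygon $Q$ is $P$ lattice-congruent to the $t$-multiple of $Q$. -}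

module Defs where

open import Data.Nat using (ℕ; zero; suc)
import Data.Nat as ℕ
open import Data.Integer using (ℤ; +_; -[1+_]; _+_; _*_; _-_; _<_; 0ℤ; 1ℤ; -1ℤ)
open import Data.Fin using (Fin; zero; suc)
open import Data.Bool using (Bool; true; false)
open import Data.Product using (Σ; ∃; _×_; _,_; proj₁; proj₂)
open import Data.Sum using (_⊎_)
open import Data.Vec using (Vec; lookup; []; _∷_)
open import Relation.Binary.PropositionalEquality using (_≡_; _≢_)
open import Relation.Nullary using (¬_)

Pt : Set
Pt = ℤ × ℤ

_−ₚ_ : Pt → Pt → Pt
(a , b) −ₚ (c , d) = (a - c , b - d)

cross : Pt → Pt → ℤ
cross (x₁ , y₁) (x₂ , y₂) = x₁ * y₂ - y₁ * x₂

scaleₚ : ℤ → Pt → Pt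
scaleₚ t (x , y) = (t * x , t * y)

-- Lattice-affine transformations: x ↦ A x + b with A ∈ GL₂(ℤ) (det A = ±1),
-- b ∈ ℤ². These are exactly the affine bijections of ℝ² mapping ℤ² onto ℤ².
record LatticeAffine : Set where
  field
    a b c d : ℤ
    e f : ℤ
    unimodular : (a * d - b * c ≡ 1ℤ) ⊎ (a * d - b * c ≡ -1ℤ)

apply : LatticeAffine → Pt → Pt
apply T (x , y) = (a * x + b * y + e , c * x + d * y + f)
  where open LatticeAffine T

next : ∀ {m} → Fin (suc m) → Fin (suc m)
next {zero} zero = zero
next {suc m} zero = suc zero
next {suc m} (suc i) = wrap (next {m} i)
  where
  wrap : Fin (suc m) → Fin (suc (suc m))
  wrap zero = zero
  wrap (suc j) = suc (suc j)

-- A two-dimensional convex lattice polygon with 3 + k vertices, listed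
-- counterclockwise; every vertex other than the endpoints of an edge lies
-- strictly to the left of that edge (so the vertices are exactly the corners
-- of the polygon, in convex position, and the polygon is 2-dimensional).
record ConvexLatticePolygon : Set where
  field
    k : ℕ
    vert : Fin (3 ℕ.+ k) → Pt
    convex : ∀ (i j : Fin (3 ℕ.+ k)) → j ≢ i → j ≢ next i →
             0ℤ < cross (vert (next i) −ₚ vert i) (vert j −ₚ vert i)

open ConvexLatticePolygon public

-- T maps the polygon with vertex family u onto the polygon with vertex family w
-- (an affine bijection maps a convex polygon onto another iff it maps the
-- vertex set onto the vertex set).
MapsOnto : LatticeAffine → ∀ {m n} → (Fin m → Pt) → (Fin n → Pt) → Set
MapsOnto T u w = (∀ i → ∃ λ j → apply T (u i) ≡ w j)
               × (∀ j → ∃ λ i → apply T (u i) ≡ w j)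

LatticeCongruent : ∀ {m n} → (Fin m → Pt) → (Fin n → Pt) → Set
LatticeCongruent u w = Σ LatticeAffine λ T → MapsOnto T u w

multiple : ℕ → ∀ {m} → (Fin m → Pt) → (Fin m → Pt)
multiple t v i = scaleₚ (+ t) (v i)

-- Face-flags: edge i is [vert i, vert (next i)]; the Bool picks the endpoint.
Flag : ConvexLatticePolygon → Set
Flag P = Fin (3 ℕ.+ k P) × Bool

flagPts : (P : ConvexLatticePolygon) → Flag P → Pt × Pt
flagPts P (i , false) = (vert P i , vert P (next i))
flagPts P (i , true)  = (vert P (next i) , vert P i)

LatticeRegular : ConvexLatticePolygon → Set
LatticeRegular P = ∀ (φ ψ : Flag P) → Σ LatticeAffine λ T →
  MapsOnto T (vert P) (vert P)
  × apply T (proj₁ (flagPts P φ)) ≡ proj₁ (flagPts P ψ)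
  × apply T (proj₂ (flagPts P φ)) ≡ proj₂ (flagPts P ψ)

Elementary : ConvexLatticePolygon → Set
Elementary P = ∀ (t : ℕ) → 1 ℕ.< t → ∀ (Q : ConvexLatticePolygon) →
  ¬ LatticeCongruent (vert P) (multiple t (vert Q))

pt : ℤ → ℤ → Pt
pt x y = (x , y)

-2ℤ : ℤ
-2ℤ = -[1+ 1 ]

triangle1 : Fin 3 → Pt
triangle1 = lookup (pt 0ℤ 0ℤ ∷ pt 1ℤ 0ℤ ∷ pt 0ℤ 1ℤ ∷ [])

triangle2 : Fin 3 → Pt
triangle2 = lookup (pt 0ℤ 0ℤ ∷ pt 1ℤ 0ℤ ∷ pt (+ 2) (+ 3) ∷ [])

square3 : Fin 4 → Pt
square3 = lookup (pt 0ℤ 0ℤ ∷ pt 1ℤ 0ℤ ∷ pt 1ℤ 1ℤ ∷ pt 0ℤ 1ℤ ∷ [])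

parallelogram4 : Fin 4 → Pt
parallelogram4 = lookup (pt 0ℤ 0ℤ ∷ pt 1ℤ 0ℤ ∷ pt (+ 2) (+ 2) ∷ pt 1ℤ (+ 2) ∷ [])

hexagon5 : Fin 6 → Pt
hexagon5 = lookup (pt 1ℤ 0ℤ ∷ pt 0ℤ 1ℤ ∷ pt -1ℤ 1ℤ
                 ∷ pt -1ℤ 0ℤ ∷ pt 0ℤ -1ℤ ∷ pt 1ℤ -1ℤ ∷ [])

hexagon6 : Fin 6 → Pt
hexagon6 = lookup (pt (+ 2) 1ℤ ∷ pt 1ℤ (+ 2) ∷ pt -1ℤ 1ℤ
                 ∷ pt -2ℤ -1ℤ ∷ pt -1ℤ -2ℤ ∷ pt 1ℤ -1ℤ ∷ [])

-- A flag-transitive symmetry group contains a rotation σ advancing every vertex to the next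
-- one and a reflection τ reversing an edge. The edges are images of one another, so if one
-- edge vector were g > 1 times a lattice vector the polygon would be a g-multiple; hence for
-- an elementary polygon they are primitive, and a unimodular change of coordinates puts
-- three consecutive vertices at (a , d), O = (0 , 0) and I = (1 , 0) with 0 ≤ a < d. Then
-- σ (x , y) = (α x + β y + 1 , d x - a y) with β d = -1 - α a, and τ gives some β' with
-- β' d = 1 - a². Convexity forces the trace α - a of σ to be at least -1, and a trace of at
-- least 2 would make the heights along the orbit of O grow forever, so α - a ∈ {-1, 0, 1}.
-- The two divisibility conditions then force d ∣ 2 or d ∣ 3, which leaves six cases; in
-- each of them the orbit of O is one of the six polygons.

module Submission where

open import Data.Bool using (false; true)
open import Data.Empty using (⊥-elim)
open import Data.Fin as Fin using (Fin; zero; suc; toℕ; fromℕ; inject₁)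
open import Data.Fin.Properties using (all?; any?; toℕ-inject₁; toℕ-fromℕ)
open import Data.Integer as ℤ using (ℤ; +_; -[1+_]; _+_; _*_; _-_; -_; _<_; _≤_; 0ℤ; 1ℤ; -1ℤ; ∣_∣)
open import Data.Integer.DivMod using (a≡a%n+[a/n]*n; n%d<d)
import Data.Integer.Divisibility.Signed as Signed
import Data.Integer.Properties as ℤₚ
open import Data.Integer.Tactic.RingSolver using (solve-∀; solve)
open import Data.List using (_∷_; [])
open import Data.Nat as ℕ using (ℕ; zero; suc; s≤s; z≤n)
open import Data.Nat.Coprimality using (coprime-Bézout; gcd≡1⇒coprime)
open import Data.Nat.Divisibility using (_∣_; _∣?_; divides; ∣⇒≤)
open import Data.Nat.GCD using (gcd; gcd[m,n]∣m; gcd[m,n]∣n; gcd[m,n]≡0⇒m≡0; gcd[m,n]≡0⇒n≡0; module Bézout)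
import Data.Nat.Properties as ℕₚ
open import Data.Product using (Σ; ∃; ∃₂; _×_; _,_; proj₁; proj₂)
open import Data.Product.Properties using (≡-dec)
open import Data.Sum as Sum using (_⊎_; inj₁; inj₂; [_,_]′)
open import Function using (_∘_; id)
open import Relation.Binary using (DecidableEquality)
open import Relation.Binary.PropositionalEquality
open import Relation.Nullary using (¬_; Dec; yes; no)
open import Relation.Nullary.Decidable using (True; False; toWitness; toWitnessFalse; _×-dec_)

open import Defs

module _ {A : Set} where
  open import Function.Endo.Propositional A public using (_^_)

  ^-cong : ∀ {f g : A → A} → (∀ p → f p ≡ g p) → ∀ m x → (f ^ m) x ≡ (g ^ m) x
  ^-cong f≗g zero x = refl
  ^-cong {f} {g} f≗g (suc m) x = trans (f≗g ((f ^ m) x)) (cong g (^-cong f≗g m x))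

O I : Pt
O = (0ℤ , 0ℤ)
I = (1ℤ , 0ℤ)

positive-factorˡ : ∀ n {c} → 0ℤ < + n * c → 0ℤ < c
positive-factorˡ n {c} h = ℤₚ.*-cancelˡ-<-nonNeg (+ n) (subst (_< + n * c) (sym (ℤₚ.*-zeroʳ (+ n))) h)

positive-factorʳ : ∀ n {c} → 0ℤ < c * + n → 0ℤ < c
positive-factorʳ n {c} h = positive-factorˡ n (subst (0ℤ <_) (ℤₚ.*-comm c (+ n)) h)

IsUnit : ℤ → Set
IsUnit u = u ≡ 1ℤ ⊎ u ≡ -1ℤ

unit-* : ∀ {u v} → IsUnit u → IsUnit v → IsUnit (u * v)
unit-* (inj₁ refl) (inj₁ refl) = inj₁ refl
unit-* (inj₁ refl) (inj₂ refl) = inj₂ refl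
unit-* (inj₂ refl) (inj₁ refl) = inj₂ refl
unit-* (inj₂ refl) (inj₂ refl) = inj₁ refl

unit-square : ∀ {u} → IsUnit u → u * u ≡ 1ℤ
unit-square (inj₁ refl) = refl
unit-square (inj₂ refl) = refl

det : LatticeAffine → ℤ
det T = a * d - b * c where open LatticeAffine T

linear : LatticeAffine → Pt → Pt
linear T (x , y) = (a * x + b * y , c * x + d * y) where open LatticeAffine T

apply-−ₚ : ∀ T p q → apply T p −ₚ apply T q ≡ linear T (p −ₚ q)
apply-−ₚ T (x , y) (x' , y') = cong₂ _,_ (row a b e) (row c d f)
  where
  open LatticeAffine T
  row : ∀ a b e → (a * x + b * y + e) - (a * x' + b * y' + e) ≡ a * (x - x') + b * (y - y')
  row a b e = solve (a ∷ b ∷ e ∷ x ∷ y ∷ x' ∷ y' ∷ [])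

cross-linear : ∀ T u w → cross (linear T u) (linear T w) ≡ det T * cross u w
cross-linear T (u₁ , u₂) (w₁ , w₂) = identity a b c d
  where
  open LatticeAffine T
  identity : ∀ a b c d → (a * u₁ + b * u₂) * (c * w₁ + d * w₂) - (c * u₁ + d * u₂) * (a * w₁ + b * w₂)
                         ≡ (a * d - b * c) * (u₁ * w₂ - u₂ * w₁)
  identity a b c d = solve (a ∷ b ∷ c ∷ d ∷ u₁ ∷ u₂ ∷ w₁ ∷ w₂ ∷ [])

idᴬ : LatticeAffine
idᴬ = record { a = 1ℤ ; b = 0ℤ ; c = 0ℤ ; d = 1ℤ ; e = 0ℤ ; f = 0ℤ ; unimodular = inj₁ refl }

apply-idᴬ : ∀ p → apply idᴬ p ≡ p
apply-idᴬ (x , y) = cong₂ _,_ (solve (x ∷ y ∷ [])) (solve (x ∷ y ∷ []))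

infixr 9 _∘ᴬ_

_∘ᴬ_ : LatticeAffine → LatticeAffine → LatticeAffine
U ∘ᴬ T = record
  { a = U.a * T.a + U.b * T.c ; b = U.a * T.b + U.b * T.d
  ; c = U.c * T.a + U.d * T.c ; d = U.c * T.b + U.d * T.d
  ; e = U.a * T.e + U.b * T.f + U.e ; f = U.c * T.e + U.d * T.f + U.f
  ; unimodular = subst IsUnit (sym (det-∘ U.a U.b U.c U.d T.a T.b T.c T.d)) (unit-* U.unimodular T.unimodular)
  }
  where
  module U = LatticeAffine U
  module T = LatticeAffine T
  det-∘ : ∀ a b c d a' b' c' d' → (a * a' + b * c') * (c * b' + d * d') - (a * b' + b * d') * (c * a' + d * c')
                                  ≡ (a * d - b * c) * (a' * d' - b' * c')
  det-∘ = solve-∀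

apply-∘ : ∀ U T p → apply (U ∘ᴬ T) p ≡ apply U (apply T p)
apply-∘ U record { a = a ; b = b ; c = c ; d = d ; e = e ; f = f } (x , y) =
  cong₂ _,_ (row U.a U.b U.e) (row U.c U.d U.f)
  where
  module U = LatticeAffine U
  row : ∀ a' b' e' → (a' * a + b' * c) * x + (a' * b + b' * d) * y + (a' * e + b' * f + e')
                     ≡ a' * (a * x + b * y + e) + b' * (c * x + d * y + f) + e'
  row a' b' e' = solve (a' ∷ b' ∷ e' ∷ a ∷ b ∷ c ∷ d ∷ e ∷ f ∷ x ∷ y ∷ [])

-- The inverse of x ↦ A x + v is x ↦ D adj(A) (x - v), where D = det A = ±1.
_⁻¹ᴬ : LatticeAffine → LatticeAffine
T ⁻¹ᴬ = record
  { a = D * d ; b = - (D * b) ; c = - (D * c) ; d = D * a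
  ; e = - (D * d * e - D * b * f) ; f = - (D * a * f - D * c * e)
  ; unimodular = subst IsUnit (sym (det-adj a b c d)) (unit-* (unit-* unimodular unimodular) unimodular)
  }
  where
  open LatticeAffine T
  D : ℤ
  D = det T
  det-adj : ∀ a b c d → let D = a * d - b * c in
            D * d * (D * a) - - (D * b) * - (D * c) ≡ D * D * D
  det-adj = solve-∀

apply-inverseˡ : ∀ T p → apply (T ⁻¹ᴬ) (apply T p) ≡ p
apply-inverseˡ record { a = a ; b = b ; c = c ; d = d ; e = e ; f = f ; unimodular = u } (x , y) =
  cong₂ _,_ (trans (row₁ (a * d - b * c)) (cancel x)) (trans (row₂ (a * d - b * c)) (cancel y))
  where
  cancel : ∀ z → (a * d - b * c) * (a * d - b * c) * z ≡ z
  cancel z = trans (cong (_* z) (unit-square u)) (ℤₚ.*-identityˡ z)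
  row₁ : ∀ D → D * d * (a * x + b * y + e) + - (D * b) * (c * x + d * y + f) + - (D * d * e - D * b * f)
               ≡ D * (a * d - b * c) * x
  row₁ D = solve (D ∷ a ∷ b ∷ c ∷ d ∷ e ∷ f ∷ x ∷ y ∷ [])
  row₂ : ∀ D → - (D * c) * (a * x + b * y + e) + D * a * (c * x + d * y + f) + - (D * a * f - D * c * e)
               ≡ D * (a * d - b * c) * y
  row₂ D = solve (D ∷ a ∷ b ∷ c ∷ d ∷ e ∷ f ∷ x ∷ y ∷ [])

apply-injective : ∀ T {p q} → apply T p ≡ apply T q → p ≡ q
apply-injective T {p} {q} eq = begin
  p                             ≡⟨ apply-inverseˡ T p ⟨
  apply (T ⁻¹ᴬ) (apply T p)     ≡⟨ cong (apply (T ⁻¹ᴬ)) eq ⟩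
  apply (T ⁻¹ᴬ) (apply T q)     ≡⟨ apply-inverseˡ T q ⟩
  q                             ∎
  where open ≡-Reasoning

translation : Pt → LatticeAffine
translation (x₀ , y₀) =
  record { a = 1ℤ ; b = 0ℤ ; c = 0ℤ ; d = 1ℤ ; e = - x₀ ; f = - y₀ ; unimodular = inj₁ refl }

apply-translation : ∀ o p → apply (translation o) p ≡ p −ₚ o
apply-translation (x₀ , y₀) (x , y) = cong₂ _,_ row₁ row₂
  where
  row₁ : 1ℤ * x + 0ℤ * y + - x₀ ≡ x - x₀
  row₁ = solve (x ∷ y ∷ x₀ ∷ [])
  row₂ : 0ℤ * x + 1ℤ * y + - y₀ ≡ y - y₀
  row₂ = solve (x ∷ y ∷ y₀ ∷ [])

orient : Pt → Pt → Pt → ℤ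
orient p q r = cross (q −ₚ p) (r −ₚ p)

orient-rotate : ∀ p q r → orient p q r ≡ orient q r p
orient-rotate (p₁ , p₂) (q₁ , q₂) (r₁ , r₂) = identity
  where
  identity : (q₁ - p₁) * (r₂ - p₂) - (q₂ - p₂) * (r₁ - p₁)
             ≡ (r₁ - q₁) * (p₂ - q₂) - (r₂ - q₂) * (p₁ - q₁)
  identity = solve (p₁ ∷ p₂ ∷ q₁ ∷ q₂ ∷ r₁ ∷ r₂ ∷ [])

orient-swap : ∀ p q r → orient q p r ≡ - orient p q r
orient-swap (p₁ , p₂) (q₁ , q₂) (r₁ , r₂) = identity
  where
  identity : (p₁ - q₁) * (r₂ - q₂) - (p₂ - q₂) * (r₁ - q₁)
             ≡ - ((q₁ - p₁) * (r₂ - p₂) - (q₂ - p₂) * (r₁ - p₁))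
  identity = solve (p₁ ∷ p₂ ∷ q₁ ∷ q₂ ∷ r₁ ∷ r₂ ∷ [])

orient-asym : ∀ p q r → 0ℤ < orient p q r → ¬ 0ℤ < orient q p r
orient-asym p q r pos pos' =
  ℤₚ.<-asym pos (ℤₚ.neg-cancel-< (subst (0ℤ <_) (orient-swap p q r) pos'))

orient-degenerateˡ : ∀ p r → orient p p r ≡ 0ℤ
orient-degenerateˡ (p₁ , p₂) (r₁ , r₂) = identity
  where
  identity : (p₁ - p₁) * (r₂ - p₂) - (p₂ - p₂) * (r₁ - p₁) ≡ 0ℤ
  identity = solve (p₁ ∷ p₂ ∷ r₁ ∷ r₂ ∷ [])

orient-degenerateʳ : ∀ p q → orient p q p ≡ 0ℤ
orient-degenerateʳ (p₁ , p₂) (q₁ , q₂) = identity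
  where
  identity : (q₁ - p₁) * (p₂ - p₂) - (q₂ - p₂) * (p₁ - p₁) ≡ 0ℤ
  identity = solve (p₁ ∷ p₂ ∷ q₁ ∷ q₂ ∷ [])

orient-apply : ∀ T p q r → orient (apply T p) (apply T q) (apply T r) ≡ det T * orient p q r
orient-apply T p q r =
  trans (cong₂ cross (apply-−ₚ T q p) (apply-−ₚ T r p)) (cross-linear T (q −ₚ p) (r −ₚ p))

orient-translate : ∀ o p q r → orient (p −ₚ o) (q −ₚ o) (r −ₚ o) ≡ orient p q r
orient-translate (o₁ , o₂) (p₁ , p₂) (q₁ , q₂) (r₁ , r₂) = identity
  where
  identity : ((q₁ - o₁) - (p₁ - o₁)) * ((r₂ - o₂) - (p₂ - o₂))
             - ((q₂ - o₂) - (p₂ - o₂)) * ((r₁ - o₁) - (p₁ - o₁))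
             ≡ (q₁ - p₁) * (r₂ - p₂) - (q₂ - p₂) * (r₁ - p₁)
  identity = solve (o₁ ∷ o₂ ∷ p₁ ∷ p₂ ∷ q₁ ∷ q₂ ∷ r₁ ∷ r₂ ∷ [])

orient-scale : ∀ g p q r → orient (scaleₚ g p) (scaleₚ g q) (scaleₚ g r) ≡ g * (g * orient p q r)
orient-scale g (p₁ , p₂) (q₁ , q₂) (r₁ , r₂) = identity
  where
  identity : (g * q₁ - g * p₁) * (g * r₂ - g * p₂) - (g * q₂ - g * p₂) * (g * r₁ - g * p₁)
             ≡ g * (g * ((q₁ - p₁) * (r₂ - p₂) - (q₂ - p₂) * (r₁ - p₁)))
  identity = solve (g ∷ p₁ ∷ p₂ ∷ q₁ ∷ q₂ ∷ r₁ ∷ r₂ ∷ [])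

next-fromℕ : ∀ m → next (fromℕ m) ≡ zero
next-fromℕ zero = refl
next-fromℕ (suc m) rewrite next-fromℕ m = refl

next-inject₁ : ∀ {m} (i : Fin (suc m)) → next (inject₁ i) ≡ suc i
next-inject₁ {zero} zero = refl
next-inject₁ {suc m} zero = refl
next-inject₁ {suc m} (suc i) rewrite next-inject₁ i = refl

next^-toℕ : ∀ {m} n (i : Fin (suc m)) → toℕ i ≡ n → (next ^ n) zero ≡ i
next^-toℕ zero zero _ = refl
next^-toℕ {suc m} (suc n) (suc i) eq = begin
  next ((next ^ n) zero) ≡⟨ cong next (next^-toℕ n (inject₁ i) toℕ-inject₁≡n) ⟩
  next (inject₁ i)       ≡⟨ next-inject₁ i ⟩
  suc i                  ∎
  where
  open ≡-Reasoning
  toℕ-inject₁≡n : toℕ (inject₁ i) ≡ n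
  toℕ-inject₁≡n = trans (toℕ-inject₁ i) (ℕₚ.suc-injective eq)

next^-toℕ-id : ∀ {m} (i : Fin (suc m)) → (next ^ toℕ i) zero ≡ i
next^-toℕ-id i = next^-toℕ (toℕ i) i refl

next-zero-or-suc : ∀ {m} (i : Fin (suc m)) → next i ≡ zero ⊎ toℕ (next i) ≡ suc (toℕ i)
next-zero-or-suc {zero} zero = inj₁ refl
next-zero-or-suc {suc m} zero = inj₂ refl
next-zero-or-suc {suc m} (suc i) with next i | next-zero-or-suc i
... | zero  | _       = inj₁ refl
... | suc _ | inj₂ eq = inj₂ (cong suc eq)

third-index : ∀ {k} (i : Fin (3 ℕ.+ k)) → ∃ λ j → j ≢ i × j ≢ next i
third-index zero = suc (suc zero) , (λ ()) , (λ ())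
third-index (suc zero) = zero , (λ ()) , (λ ())
third-index (suc (suc i)) = suc zero , (λ ()) , one≢next (next-zero-or-suc (suc (suc i)))
  where
  one≢next : _ → suc zero ≢ next (suc (suc i))
  one≢next (inj₁ next≡0) eq with trans eq next≡0
  ... | ()
  one≢next (inj₂ toℕ-next) eq with trans (cong toℕ eq) toℕ-next
  ... | ()

IsEdge : ConvexLatticePolygon → Pt → Pt → Set
IsEdge P p q = ∀ j → vert P j ≢ p → vert P j ≢ q → 0ℤ < orient p q (vert P j)

module _ (P : ConvexLatticePolygon) where

  edge-isEdge : ∀ i → IsEdge P (vert P i) (vert P (next i))
  edge-isEdge i j j≢i j≢next = convex P i j (λ { refl → j≢i refl }) (λ { refl → j≢next refl })

  edge-nondegenerate : ∀ i → vert P i ≢ vert P (next i)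
  edge-nondegenerate i eq with third-index i
  ... | j , j≢i , j≢next = ℤₚ.<-irrefl (sym (orient-degenerateˡ (vert P i) (vert P j)))
    (subst (λ q → 0ℤ < orient (vert P i) q (vert P j)) (sym eq) (convex P i j j≢i j≢next))

  vert-injective : ∀ {i j} → vert P i ≡ vert P j → i ≡ j
  vert-injective {i} {j} eq with j Fin.≟ i | j Fin.≟ next i
  ... | yes j≡i | _ = sym j≡i
  ... | no _ | yes refl = ⊥-elim (edge-nondegenerate i eq)
  ... | no j≢i | no j≢next = ⊥-elim (ℤₚ.<-irrefl (sym (orient-degenerateʳ (vert P i) (vert P (next i))))
    (subst (λ r → 0ℤ < orient (vert P i) (vert P (next i)) r) (sym eq) (convex P i j j≢i j≢next)))

  ¬reversed-edge : ∀ i → ¬ IsEdge P (vert P (next i)) (vert P i)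
  ¬reversed-edge i reversed with third-index i
  ... | j , j≢i , j≢next = orient-asym (vert P i) (vert P (next i)) (vert P j)
    (convex P i j j≢i j≢next)
    (reversed j (λ eq → j≢next (vert-injective eq)) (λ eq → j≢i (vert-injective eq)))

  edge-target-unique : ∀ {p j j'} → IsEdge P p (vert P j) → IsEdge P p (vert P j') →
                       vert P j ≢ p → vert P j' ≢ p → j ≡ j'
  edge-target-unique {p} {j} {j'} pj pj' j≢p j'≢p with j Fin.≟ j'
  ... | yes j≡j' = j≡j'
  ... | no j≢j' = ⊥-elim (orient-asym p (vert P j) (vert P j')
    (pj j' j'≢p (λ eq → j≢j' (sym (vert-injective eq))))
    (subst (0ℤ <_) (trans (orient-rotate p (vert P j') (vert P j)) (orient-rotate (vert P j') (vert P j) p))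
      (pj' j j≢p (λ eq → j≢j' (vert-injective eq)))))

Symmetry : ConvexLatticePolygon → LatticeAffine → Set
Symmetry P T = MapsOnto T (vert P) (vert P)

module _ {P : ConvexLatticePolygon} {T : LatticeAffine} (symmetry : Symmetry P T) where

  private
    edge-image : ∀ {p q} → IsEdge P p q → ∀ j → vert P j ≢ apply T p → vert P j ≢ apply T q →
                 ∃ λ x → 0ℤ < x × orient (apply T p) (apply T q) (vert P j) ≡ det T * x
    edge-image {p} {q} pq j j≢Tp j≢Tq =
      let i , Ti≡j = proj₂ symmetry j in
      orient p q (vert P i) ,
      pq i (λ { refl → j≢Tp (sym Ti≡j) }) (λ { refl → j≢Tq (sym Ti≡j) }) ,
      trans (cong (orient (apply T p) (apply T q)) (sym Ti≡j)) (orient-apply T p q (vert P i))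

    image-distinct : ∀ {i i' j} → vert P i ≢ vert P i' → apply T (vert P i) ≡ vert P j →
                     ∃ λ j' → apply T (vert P i') ≡ vert P j' × vert P j' ≢ vert P j
    image-distinct {i} {i'} i≢i' Ti≡j =
      let j' , Ti'≡j' = proj₁ symmetry i' in
      j' , Ti'≡j' , λ eq → i≢i' (sym (apply-injective T (trans Ti'≡j' (trans eq (sym Ti≡j)))))

  isEdge-preserved : det T ≡ 1ℤ → ∀ {p q} → IsEdge P p q → IsEdge P (apply T p) (apply T q)
  isEdge-preserved det≡1 pq j j≢Tp j≢Tq =
    let x , x>0 , eq = edge-image pq j j≢Tp j≢Tq in
    subst (0ℤ <_) (sym (trans eq (trans (cong (_* x) det≡1) (ℤₚ.*-identityˡ x)))) x>0

  isEdge-reversed : det T ≡ -1ℤ → ∀ {p q} → IsEdge P p q → IsEdge P (apply T q) (apply T p)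
  isEdge-reversed det≡-1 {p} {q} pq j j≢Tq j≢Tp =
    let x , x>0 , eq = edge-image pq j j≢Tp j≢Tq in
    subst (0ℤ <_) (sym (begin
      orient (apply T q) (apply T p) (vert P j)   ≡⟨ orient-swap (apply T p) (apply T q) (vert P j) ⟩
      - orient (apply T p) (apply T q) (vert P j) ≡⟨ cong -_ (trans eq (cong (_* x) det≡-1)) ⟩
      - (-1ℤ * x)                                 ≡⟨ cong -_ (ℤₚ.-1*i≡-i x) ⟩
      - - x                                       ≡⟨ ℤₚ.neg-involutive x ⟩
      x                                           ∎)) x>0
    where open ≡-Reasoning

  symmetry-next : det T ≡ 1ℤ → ∀ {i j} → apply T (vert P i) ≡ vert P j →
                  apply T (vert P (next i)) ≡ vert P (next j)
  symmetry-next det≡1 {i} {j} Ti≡j =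
    let j' , Tn≡j' , j'≢j = image-distinct (edge-nondegenerate P i) Ti≡j
        image = subst₂ (IsEdge P) Ti≡j Tn≡j' (isEdge-preserved det≡1 (edge-isEdge P i))
    in trans Tn≡j' (cong (vert P) (edge-target-unique P image (edge-isEdge P j) j'≢j (edge-nondegenerate P j ∘ sym)))

  symmetry-prev : det T ≡ -1ℤ → ∀ {i j} → apply T (vert P (next i)) ≡ vert P j →
                  apply T (vert P i) ≡ vert P (next j)
  symmetry-prev det≡-1 {i} {j} Tn≡j =
    let j' , Ti≡j' , j'≢j = image-distinct (edge-nondegenerate P i ∘ sym) Tn≡j
        image = subst₂ (IsEdge P) Tn≡j Ti≡j' (isEdge-reversed det≡-1 (edge-isEdge P i))
    in trans Ti≡j' (cong (vert P) (edge-target-unique P image (edge-isEdge P j) j'≢j (edge-nondegenerate P j ∘ sym)))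

  preserving⇒det≡1 : ∀ {i j} → apply T (vert P i) ≡ vert P j →
                     apply T (vert P (next i)) ≡ vert P (next j) → det T ≡ 1ℤ
  preserving⇒det≡1 {i} {j} Ti≡j Tn≡n = by-orientation (LatticeAffine.unimodular T)
    where
    by-orientation : IsUnit (det T) → det T ≡ 1ℤ
    by-orientation (inj₁ det≡1) = det≡1
    by-orientation (inj₂ det≡-1) =
      ⊥-elim (¬reversed-edge P j (subst₂ (IsEdge P) Tn≡n Ti≡j (isEdge-reversed det≡-1 (edge-isEdge P i))))

  reversing⇒det≡-1 : ∀ {i j} → apply T (vert P i) ≡ vert P (next j) →
                     apply T (vert P (next i)) ≡ vert P j → det T ≡ -1ℤ
  reversing⇒det≡-1 {i} {j} Ti≡n Tn≡j = by-orientation (LatticeAffine.unimodular T)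
    where
    by-orientation : IsUnit (det T) → det T ≡ -1ℤ
    by-orientation (inj₁ det≡1) =
      ⊥-elim (¬reversed-edge P j (subst₂ (IsEdge P) Ti≡n Tn≡j (isEdge-preserved det≡1 (edge-isEdge P i))))
    by-orientation (inj₂ det≡-1) = det≡-1

  rotation-orbit : det T ≡ 1ℤ → apply T (vert P zero) ≡ vert P (suc zero) →
                   ∀ m → vert P ((next ^ m) zero) ≡ (apply T ^ m) (vert P zero)
  rotation-orbit det≡1 T0≡1 = orbit
    where
    shift : ∀ m → apply T (vert P ((next ^ m) zero)) ≡ vert P ((next ^ suc m) zero)
    shift zero = T0≡1
    shift (suc m) = symmetry-next det≡1 (shift m)
    orbit : ∀ m → vert P ((next ^ m) zero) ≡ (apply T ^ m) (vert P zero)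
    orbit zero = refl
    orbit (suc m) = trans (sym (shift m)) (cong (apply T) (orbit m))

transform : (P : ConvexLatticePolygon) (T : LatticeAffine) → det T ≡ 1ℤ → ConvexLatticePolygon
transform P T det≡1 = record
  { k = k P
  ; vert = apply T ∘ vert P
  ; convex = λ i j j≢i j≢next → subst (0ℤ <_) (sym (preserved i j)) (convex P i j j≢i j≢next)
  }
  where
  preserved : ∀ i j → orient (apply T (vert P i)) (apply T (vert P (next i))) (apply T (vert P j))
                      ≡ orient (vert P i) (vert P (next i)) (vert P j)
  preserved i j = trans (orient-apply T _ _ _) (trans (cong (_* _) det≡1) (ℤₚ.*-identityˡ _))

mapsOnto-∘ : ∀ {T U l m n} {u : Fin l → Pt} {v : Fin m → Pt} {w : Fin n → Pt} →
             MapsOnto T u v → MapsOnto U v w → MapsOnto (U ∘ᴬ T) u w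
mapsOnto-∘ {T} {U} {u = u} {v} {w} (T-into , T-onto) (U-into , U-onto) = into , onto
  where
  into : ∀ i → ∃ λ k → apply (U ∘ᴬ T) (u i) ≡ w k
  into i = let j , Ti≡j = T-into i ; k , Uj≡k = U-into j in
    k , trans (apply-∘ U T (u i)) (trans (cong (apply U) Ti≡j) Uj≡k)
  onto : ∀ k → ∃ λ i → apply (U ∘ᴬ T) (u i) ≡ w k
  onto k = let j , Uj≡k = U-onto k ; i , Ti≡j = T-onto j in
    i , trans (apply-∘ U T (u i)) (trans (cong (apply U) Ti≡j) Uj≡k)

congruent-trans : ∀ {l m n} {u : Fin l → Pt} {v : Fin m → Pt} {w : Fin n → Pt} →
                  LatticeCongruent u v → LatticeCongruent v w → LatticeCongruent u w
congruent-trans {u = u} {v} {w} (T , T-onto) (U , U-onto) = U ∘ᴬ T , mapsOnto-∘ {T} {U} {u = u} {v} {w} T-onto U-onto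

conjugate-image : ∀ T S {p q p' q'} → p' ≡ apply T p → q' ≡ apply T q → apply S p ≡ q →
                  apply (T ∘ᴬ S ∘ᴬ T ⁻¹ᴬ) p' ≡ q'
conjugate-image T S {p} {q} refl refl Sp≡q = begin
  apply (T ∘ᴬ S ∘ᴬ T ⁻¹ᴬ) (apply T p)           ≡⟨ apply-∘ T (S ∘ᴬ T ⁻¹ᴬ) (apply T p) ⟩
  apply T (apply (S ∘ᴬ T ⁻¹ᴬ) (apply T p))      ≡⟨ cong (apply T) (apply-∘ S (T ⁻¹ᴬ) (apply T p)) ⟩
  apply T (apply S (apply (T ⁻¹ᴬ) (apply T p))) ≡⟨ cong (apply T ∘ apply S) (apply-inverseˡ T p) ⟩
  apply T (apply S p)                           ≡⟨ cong (apply T) Sp≡q ⟩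
  apply T q                                     ∎
  where open ≡-Reasoning

mapsOnto-conjugate : ∀ T S {m n} {u : Fin m → Pt} {v : Fin n → Pt} →
                     MapsOnto S u v → MapsOnto (T ∘ᴬ S ∘ᴬ T ⁻¹ᴬ) (apply T ∘ u) (apply T ∘ v)
mapsOnto-conjugate T S (into , onto) =
  (λ i → proj₁ (into i) , conjugate-image T S refl refl (proj₂ (into i))) ,
  (λ j → proj₁ (onto j) , conjugate-image T S refl refl (proj₂ (onto j)))

module _ (P : ConvexLatticePolygon) (T : LatticeAffine) (det≡1 : det T ≡ 1ℤ) where

  transform-congruent : LatticeCongruent (vert P) (vert (transform P T det≡1))
  transform-congruent = T , (λ i → i , refl) , (λ i → i , refl)

  private
    flag₁ : ∀ φ → proj₁ (flagPts (transform P T det≡1) φ) ≡ apply T (proj₁ (flagPts P φ))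
    flag₁ (i , false) = refl
    flag₁ (i , true) = refl

    flag₂ : ∀ φ → proj₂ (flagPts (transform P T det≡1) φ) ≡ apply T (proj₂ (flagPts P φ))
    flag₂ (i , false) = refl
    flag₂ (i , true) = refl

  transform-regular : LatticeRegular P → LatticeRegular (transform P T det≡1)
  transform-regular regular φ ψ =
    let S , S-onto , S-flag₁ , S-flag₂ = regular φ ψ
    in T ∘ᴬ S ∘ᴬ T ⁻¹ᴬ , mapsOnto-conjugate T S S-onto ,
       conjugate-image T S (flag₁ φ) (flag₁ ψ) S-flag₁ , conjugate-image T S (flag₂ φ) (flag₂ ψ) S-flag₂

-- Elementary polygons

infix 4 _∣ₚ_

_∣ₚ_ : ℕ → Pt → Set
g ∣ₚ u = ∃ λ w → u ≡ scaleₚ (+ g) w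

∣ₚ-−ₚ-refl : ∀ g p → g ∣ₚ (p −ₚ p)
∣ₚ-−ₚ-refl g (x , y) = O , cong₂ _,_ (zero-multiple x) (zero-multiple y)
  where
  zero-multiple : ∀ z → z - z ≡ + g * 0ℤ
  zero-multiple z = trans (ℤₚ.+-inverseʳ z) (sym (ℤₚ.*-zeroʳ (+ g)))

∣ₚ-−ₚ-trans : ∀ {g p q r} → g ∣ₚ (r −ₚ q) → g ∣ₚ (q −ₚ p) → g ∣ₚ (r −ₚ p)
∣ₚ-−ₚ-trans {g} {p₁ , p₂} {q₁ , q₂} {r₁ , r₂} ((u₁ , u₂) , rq) ((v₁ , v₂) , qp) =
  (u₁ + v₁ , u₂ + v₂) ,
  cong₂ _,_ (sum {r₁} {q₁} {p₁} (cong proj₁ rq) (cong proj₁ qp))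
            (sum {r₂} {q₂} {p₂} (cong proj₂ rq) (cong proj₂ qp))
  where
  sum : ∀ {r q p u v} → r - q ≡ + g * u → q - p ≡ + g * v → r - p ≡ + g * (u + v)
  sum {r} {q} {p} {u} {v} rq qp = begin
    r - p             ≡⟨ solve (r ∷ q ∷ p ∷ []) ⟩
    (r - q) + (q - p) ≡⟨ cong₂ _+_ rq qp ⟩
    + g * u + + g * v ≡⟨ ℤₚ.*-distribˡ-+ (+ g) u v ⟨
    + g * (u + v)     ∎
    where open ≡-Reasoning

linear-scale : ∀ T g w → linear T (scaleₚ g w) ≡ scaleₚ g (linear T w)
linear-scale record { a = a ; b = b ; c = c ; d = d } g (w₁ , w₂) = cong₂ _,_ (row a b) (row c d)
  where
  row : ∀ a b → a * (g * w₁) + b * (g * w₂) ≡ g * (a * w₁ + b * w₂)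
  row a b = solve (a ∷ b ∷ g ∷ w₁ ∷ w₂ ∷ [])

module _ {P : ConvexLatticePolygon} (regular : LatticeRegular P) {g}
         (g∣edge : g ∣ₚ (vert P (suc zero) −ₚ vert P zero)) where

  edges-multiple : ∀ i → g ∣ₚ (vert P (next i) −ₚ vert P i)
  edges-multiple i =
    let S , _ , S0≡i , S1≡next = regular (zero , false) (i , false)
        w , edge≡gw = g∣edge
    in linear S w , (begin
      vert P (next i) −ₚ vert P i                           ≡⟨ cong₂ _−ₚ_ S1≡next S0≡i ⟨
      apply S (vert P (suc zero)) −ₚ apply S (vert P zero)  ≡⟨ apply-−ₚ S _ _ ⟩
      linear S (vert P (suc zero) −ₚ vert P zero)           ≡⟨ cong (linear S) edge≡gw ⟩
      linear S (scaleₚ (+ g) w)                             ≡⟨ linear-scale S (+ g) w ⟩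
      scaleₚ (+ g) (linear S w)                             ∎)
    where open ≡-Reasoning

  vertices-multiple : ∀ i → g ∣ₚ (vert P i −ₚ vert P zero)
  vertices-multiple i = subst (λ j → g ∣ₚ (vert P j −ₚ vert P zero)) (next^-toℕ-id i) (along (toℕ i))
    where
    along : ∀ m → g ∣ₚ (vert P ((next ^ m) zero) −ₚ vert P zero)
    along zero = ∣ₚ-−ₚ-refl g (vert P zero)
    along (suc m) = ∣ₚ-−ₚ-trans {g} {vert P zero} {vert P ((next ^ m) zero)} {vert P ((next ^ suc m) zero)}
                      (edges-multiple ((next ^ m) zero)) (along m)

cong-orient : ∀ {p p' q q' r r'} → p ≡ p' → q ≡ q' → r ≡ r' → orient p q r ≡ orient p' q' r'
cong-orient refl refl refl = refl

module _ (P : ConvexLatticePolygon) {g} (divisible : ∀ i → g ∣ₚ (vert P i −ₚ vert P zero)) where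

  private
    u : Fin (3 ℕ.+ k P) → Pt
    u = proj₁ ∘ divisible

    scaled : ∀ i i' j → orient (vert P i) (vert P i') (vert P j) ≡ + g * (+ g * orient (u i) (u i') (u j))
    scaled i i' j = begin
      orient (vert P i) (vert P i') (vert P j)
        ≡⟨ orient-translate (vert P zero) (vert P i) (vert P i') (vert P j) ⟨
      orient (vert P i −ₚ vert P zero) (vert P i' −ₚ vert P zero) (vert P j −ₚ vert P zero)
        ≡⟨ cong-orient (proj₂ (divisible i)) (proj₂ (divisible i')) (proj₂ (divisible j)) ⟩
      orient (scaleₚ (+ g) (u i)) (scaleₚ (+ g) (u i')) (scaleₚ (+ g) (u j))
        ≡⟨ orient-scale (+ g) (u i) (u i') (u j) ⟩
      + g * (+ g * orient (u i) (u i') (u j))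
        ∎
      where open ≡-Reasoning

  quotient : ConvexLatticePolygon
  quotient = record
    { k = k P
    ; vert = u
    ; convex = λ i j j≢i j≢next → positive-factorˡ g (positive-factorˡ g
        (subst (0ℤ <_) (scaled i (next i) j) (convex P i j j≢i j≢next)))
    }

  quotient-congruent : LatticeCongruent (vert P) (multiple g (vert quotient))
  quotient-congruent = translation (vert P zero) , (λ i → i , shifted i) , (λ i → i , shifted i)
    where
    shifted : ∀ i → apply (translation (vert P zero)) (vert P i) ≡ scaleₚ (+ g) (u i)
    shifted i = trans (apply-translation (vert P zero) (vert P i)) (proj₂ (divisible i))

Primitive : Pt → Set
Primitive (p , q) = ∃₂ λ l m → l * p + m * q ≡ 1ℤ

private
  ℕ-Bézout-in-ℤ : ∀ {x y m n} → 1 ℕ.+ y ℕ.* n ≡ x ℕ.* m → 1ℤ + + y * + n ≡ + x * + m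
  ℕ-Bézout-in-ℤ {x} {y} {m} {n} eq = begin
    1ℤ + + y * + n     ≡⟨ cong (λ z → 1ℤ + z) (ℤₚ.pos-* y n) ⟨
    1ℤ + + (y ℕ.* n)   ≡⟨ ℤₚ.pos-+ 1 (y ℕ.* n) ⟨
    + (1 ℕ.+ y ℕ.* n)  ≡⟨ cong +_ eq ⟩
    + (x ℕ.* m)        ≡⟨ ℤₚ.pos-* x m ⟩
    + x * + m          ∎
    where open ≡-Reasoning

  signed-Bézout : ∀ {p q a b X Y} s t → a ≡ s * p → b ≡ t * q → 1ℤ + Y * b ≡ X * a →
                  X * s * p + - (Y * t) * q ≡ 1ℤ
  signed-Bézout {p} {q} {a} {b} {X} {Y} s t sp tq identity = begin
    X * s * p + - (Y * t) * q ≡⟨ solve (X ∷ Y ∷ s ∷ t ∷ p ∷ q ∷ []) ⟩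
    X * (s * p) - Y * (t * q) ≡⟨ cong₂ (λ a b → X * a - Y * b) sp tq ⟨
    X * a - Y * b             ≡⟨ cong (_- Y * b) identity ⟨
    1ℤ + Y * b - Y * b        ≡⟨ solve (Y ∷ b ∷ []) ⟩
    1ℤ                        ∎
    where open ≡-Reasoning

coprime-primitive : ∀ p q → Bézout.Identity 1 ∣ p ∣ ∣ q ∣ → Primitive (p , q)
coprime-primitive p q (Bézout.+- x y eq) =
  + x * s , - (+ y * t) , signed-Bézout {X = + x} {Y = + y} s t sp tq (ℕ-Bézout-in-ℤ {x} {y} {∣ p ∣} {∣ q ∣} eq)
  where open Signed._∣_ (Signed.m∣∣m∣ {p}) renaming (quotient to s; equality to sp)
        open Signed._∣_ (Signed.m∣∣m∣ {q}) renaming (quotient to t; equality to tq)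
coprime-primitive p q (Bézout.-+ x y eq) =
  - (+ x * s) , + y * t ,
  trans (ℤₚ.+-comm (- (+ x * s) * p) (+ y * t * q))
        (signed-Bézout {X = + y} {Y = + x} t s tq sp (ℕ-Bézout-in-ℤ {y} {x} {∣ q ∣} {∣ p ∣} eq))
  where open Signed._∣_ (Signed.m∣∣m∣ {p}) renaming (quotient to s; equality to sp)
        open Signed._∣_ (Signed.m∣∣m∣ {q}) renaming (quotient to t; equality to tq)

multiple-of-coordinates : ∀ {g p q} → g ∣ ∣ p ∣ → g ∣ ∣ q ∣ → g ∣ₚ (p , q)
multiple-of-coordinates {g} {p} {q} g∣p g∣q =
  (s , t) , cong₂ _,_ (trans p≡sg (ℤₚ.*-comm s (+ g))) (trans q≡tg (ℤₚ.*-comm t (+ g)))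
  where open Signed._∣_ (Signed.∣ᵤ⇒∣ {+ g} {p} g∣p) renaming (quotient to s; equality to p≡sg)
        open Signed._∣_ (Signed.∣ᵤ⇒∣ {+ g} {q} g∣q) renaming (quotient to t; equality to q≡tg)

primitive-or-multiple : ∀ u → u ≢ O → Primitive u ⊎ ∃ λ g → 1 ℕ.< g × g ∣ₚ u
primitive-or-multiple (p , q) u≢O with gcd ∣ p ∣ ∣ q ∣ in gcd≡
... | zero = ⊥-elim (u≢O (cong₂ _,_ (ℤₚ.∣i∣≡0⇒i≡0 (gcd[m,n]≡0⇒m≡0 gcd≡))
                                    (ℤₚ.∣i∣≡0⇒i≡0 (gcd[m,n]≡0⇒n≡0 ∣ p ∣ gcd≡))))
... | suc zero = inj₁ (coprime-primitive p q (coprime-Bézout (gcd≡1⇒coprime gcd≡)))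
... | suc (suc g) = inj₂ (suc (suc g) , s≤s (s≤s z≤n) , multiple-of-coordinates
  (subst (_∣ ∣ p ∣) gcd≡ (gcd[m,n]∣m ∣ p ∣ ∣ q ∣))
  (subst (_∣ ∣ q ∣) gcd≡ (gcd[m,n]∣n ∣ p ∣ ∣ q ∣)))

−ₚ≡O⇒≡ : ∀ {p q} → p −ₚ q ≡ O → p ≡ q
−ₚ≡O⇒≡ {p₁ , p₂} {q₁ , q₂} eq =
  cong₂ _,_ (ℤₚ.i-j≡0⇒i≡j p₁ q₁ (cong proj₁ eq)) (ℤₚ.i-j≡0⇒i≡j p₂ q₂ (cong proj₂ eq))

elementary⇒primitive : ∀ P → Elementary P → LatticeRegular P → Primitive (vert P (suc zero) −ₚ vert P zero)
elementary⇒primitive P elementary regular = [ id , not-multiple ]′ (primitive-or-multiple _ edge≢O)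
  where
  edge≢O : vert P (suc zero) −ₚ vert P zero ≢ O
  edge≢O eq = edge-nondegenerate P zero (sym (−ₚ≡O⇒≡ eq))
  not-multiple : (∃ λ g → 1 ℕ.< g × g ∣ₚ (vert P (suc zero) −ₚ vert P zero)) →
                 Primitive (vert P (suc zero) −ₚ vert P zero)
  not-multiple (g , 1<g , g∣edge) =
    ⊥-elim (elementary g 1<g (quotient P {g} divisible) (quotient-congruent P {g} divisible))
    where
    divisible : ∀ i → g ∣ₚ (vert P i −ₚ vert P zero)
    divisible = vertices-multiple regular {g} g∣edge

-- Normal form

frame : ∀ p q → Primitive (q −ₚ p) → Σ LatticeAffine λ T → det T ≡ 1ℤ × apply T p ≡ O × apply T q ≡ I
frame (p₁ , p₂) (q₁ , q₂) (l , m , l·u+m·v≡1) =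
  T , det≡1 , cong₂ _,_ p-row₁ p-row₂ , cong₂ _,_ q-row₁ q-row₂
  where
  u v : ℤ
  u = q₁ - p₁
  v = q₂ - p₂
  det≡1 : l * u - m * - v ≡ 1ℤ
  det≡1 = trans (det-identity l m u v) l·u+m·v≡1
    where
    det-identity : ∀ l m u v → l * u - m * - v ≡ l * u + m * v
    det-identity = solve-∀
  T : LatticeAffine
  T = record { a = l ; b = m ; c = - v ; d = u ; e = - (l * p₁ + m * p₂) ; f = - (- v * p₁ + u * p₂)
             ; unimodular = inj₁ det≡1 }
  p-row₁ : l * p₁ + m * p₂ + - (l * p₁ + m * p₂) ≡ 0ℤ
  p-row₁ = ℤₚ.+-inverseʳ (l * p₁ + m * p₂)
  p-row₂ : - v * p₁ + u * p₂ + - (- v * p₁ + u * p₂) ≡ 0ℤ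
  p-row₂ = ℤₚ.+-inverseʳ (- v * p₁ + u * p₂)
  q-row₁ : l * q₁ + m * q₂ + - (l * p₁ + m * p₂) ≡ 1ℤ
  q-row₁ = trans (identity l m p₁ p₂ q₁ q₂) l·u+m·v≡1
    where
    identity : ∀ l m p₁ p₂ q₁ q₂ →
               l * q₁ + m * q₂ + - (l * p₁ + m * p₂) ≡ l * (q₁ - p₁) + m * (q₂ - p₂)
    identity = solve-∀
  q-row₂ : - v * q₁ + u * q₂ + - (- v * p₁ + u * p₂) ≡ 0ℤ
  q-row₂ = identity p₁ p₂ q₁ q₂
    where
    identity : ∀ p₁ p₂ q₁ q₂ → let u = q₁ - p₁ ; v = q₂ - p₂ in
               - v * q₁ + u * q₂ + - (- v * p₁ + u * p₂) ≡ 0ℤ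
    identity = solve-∀

shear-det : ∀ s → 1ℤ * 1ℤ - - s * 0ℤ ≡ 1ℤ
shear-det = solve-∀

shear : ℤ → LatticeAffine
shear s = record { a = 1ℤ ; b = - s ; c = 0ℤ ; d = 1ℤ ; e = 0ℤ ; f = 0ℤ ; unimodular = inj₁ (shear-det s) }

apply-shear : ∀ s x y → apply (shear s) (x , y) ≡ (x - s * y , y)
apply-shear s x y = cong₂ _,_ (row₁ s x y) (row₂ x y)
  where
  row₁ : ∀ s x y → 1ℤ * x + - s * y + 0ℤ ≡ x - s * y
  row₁ = solve-∀
  row₂ : ∀ x y → 0ℤ * x + 1ℤ * y + 0ℤ ≡ y
  row₂ = solve-∀

shear-O : ∀ s → apply (shear s) O ≡ O
shear-O s = trans (apply-shear s 0ℤ 0ℤ) (cong (_, 0ℤ) (cong (λ z → 0ℤ - z) (ℤₚ.*-zeroʳ s)))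

shear-I : ∀ s → apply (shear s) I ≡ I
shear-I s = trans (apply-shear s 1ℤ 0ℤ) (cong (_, 0ℤ) (cong (λ z → 1ℤ - z) (ℤₚ.*-zeroʳ s)))

shear-reduce : ∀ x n → apply (shear (x ℤ./ + suc n)) (x , + suc n) ≡ (+ (x ℤ.% + suc n) , + suc n)
shear-reduce x n = trans (apply-shear s x (+ suc n)) (cong (_, + suc n) (begin
  x - s * + suc n                              ≡⟨ cong (_- s * + suc n) (a≡a%n+[a/n]*n x (+ suc n)) ⟩
  + (x ℤ.% + suc n) + s * + suc n - s * + suc n ≡⟨ cancel (+ (x ℤ.% + suc n)) (s * + suc n) ⟩
  + (x ℤ.% + suc n)                            ∎))
  where
  s : ℤ
  s = x ℤ./ + suc n
  cancel : ∀ r t → r + t - t ≡ r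
  cancel = solve-∀
  open ≡-Reasoning

record NormalForm (P : ConvexLatticePolygon) : Set where
  field
    a d : ℕ
    a<d : a ℕ.< d
    vert-zero : vert P zero ≡ O
    vert-one : vert P (suc zero) ≡ I
    vert-last : vert P (fromℕ (2 ℕ.+ k P)) ≡ (+ a , + d)

NormalisedCopy : ConvexLatticePolygon → Set
NormalisedCopy P = Σ ConvexLatticePolygon λ P' → LatticeCongruent (vert P) (vert P') × LatticeRegular P' × NormalForm P'

positive⇒suc : ∀ {y} → 0ℤ < y → ∃ λ n → y ≡ + suc n
positive⇒suc {+ zero} (ℤ.+<+ ())
positive⇒suc {+ suc n} _ = n , refl

sheared-copy : ∀ P → LatticeRegular P → vert P zero ≡ O → vert P (suc zero) ≡ I → NormalisedCopy P
sheared-copy P regular V0≡O V1≡I =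
  P' , transform-congruent P S (shear-det s) , transform-regular P S (shear-det s) regular , record
    { a = x ℤ.% + suc n
    ; d = suc n
    ; a<d = n%d<d x (+ suc n)
    ; vert-zero = trans (cong (apply S) V0≡O) (shear-O s)
    ; vert-one = trans (cong (apply S) V1≡I) (shear-I s)
    ; vert-last = trans (cong (apply S) (cong (x ,_) y≡d)) (shear-reduce x n)
    }
  where
  ℓ : Fin (3 ℕ.+ k P)
  ℓ = fromℕ (2 ℕ.+ k P)
  x y : ℤ
  x = proj₁ (vert P ℓ)
  y = proj₂ (vert P ℓ)
  y>0 : 0ℤ < y
  y>0 = subst (0ℤ <_) (height x y)
    (subst₂ (λ p q → 0ℤ < orient p q (x , y)) V0≡O V1≡I (convex P zero ℓ (λ ()) (λ ())))
    where
    height : ∀ x y → (1ℤ - 0ℤ) * (y - 0ℤ) - (0ℤ - 0ℤ) * (x - 0ℤ) ≡ y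
    height = solve-∀
  n : ℕ
  n = proj₁ (positive⇒suc y>0)
  y≡d : y ≡ + suc n
  y≡d = proj₂ (positive⇒suc y>0)
  s : ℤ
  s = x ℤ./ + suc n
  S : LatticeAffine
  S = shear s
  P' : ConvexLatticePolygon
  P' = transform P S (shear-det s)

normal-form : ∀ P → LatticeRegular P → Primitive (vert P (suc zero) −ₚ vert P zero) → NormalisedCopy P
normal-form P regular edge-primitive =
  let T , det≡1 , T0≡O , T1≡I = frame (vert P zero) (vert P (suc zero)) edge-primitive
      P' , P₁≅P' , regular' , normal =
        sheared-copy (transform P T det≡1) (transform-regular P T det≡1 regular) T0≡O T1≡I
  in P' , congruent-trans (transform-congruent P T det≡1) P₁≅P' , regular' , normal

rotation : ℤ → ℤ → ℤ → ℤ → Pt → Pt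
rotation α β a d (x , y) = (α * x + β * y + 1ℤ , d * x - a * y)

private
  translation-part : ∀ α β ε → α * 0ℤ + β * 0ℤ + ε ≡ ε
  translation-part = solve-∀

  add-sub : ∀ u e → u + e - e ≡ u
  add-sub = solve-∀

-- (a , d) = adj M (M (a , d)) for the matrix M with rows (α , β) and (γ , δ).
cramer : ∀ {α β γ δ a d} → α * δ - β * γ ≡ 1ℤ → α * a + β * d ≡ -1ℤ → γ * a + δ * d ≡ 0ℤ →
         γ ≡ d × δ ≡ - a
cramer {α} {β} {γ} {δ} {a} {d} det≡1 first second = sym d≡γ , sym -a≡δ
  where
  open ≡-Reasoning
  d≡γ : d ≡ γ
  d≡γ = begin
    d                                         ≡⟨ ℤₚ.*-identityˡ d ⟨
    1ℤ * d                                    ≡⟨ cong (_* d) det≡1 ⟨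
    (α * δ - β * γ) * d                       ≡⟨ expand α β γ δ a d ⟩
    α * (γ * a + δ * d) - γ * (α * a + β * d) ≡⟨ cong₂ (λ u v → α * u - γ * v) second first ⟩
    α * 0ℤ - γ * -1ℤ                          ≡⟨ simplify α γ ⟩
    γ                                         ∎
    where
    expand : ∀ α β γ δ a d → (α * δ - β * γ) * d ≡ α * (γ * a + δ * d) - γ * (α * a + β * d)
    expand = solve-∀
    simplify : ∀ α γ → α * 0ℤ - γ * -1ℤ ≡ γ
    simplify = solve-∀
  -a≡δ : - a ≡ δ
  -a≡δ = begin
    - a                                           ≡⟨ cong -_ (ℤₚ.*-identityˡ a) ⟨
    - (1ℤ * a)                                    ≡⟨ cong (λ D → - (D * a)) det≡1 ⟨
    - ((α * δ - β * γ) * a)                       ≡⟨ cong -_ (expand α β γ δ a d) ⟩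
    - (δ * (α * a + β * d) - β * (γ * a + δ * d)) ≡⟨ cong₂ (λ u v → - (δ * u - β * v)) first second ⟩
    - (δ * -1ℤ - β * 0ℤ)                          ≡⟨ simplify β δ ⟩
    δ                                             ∎
    where
    expand : ∀ α β γ δ a d → (α * δ - β * γ) * a ≡ δ * (α * a + β * d) - β * (γ * a + δ * d)
    expand = solve-∀
    simplify : ∀ β δ → - (δ * -1ℤ - β * 0ℤ) ≡ δ
    simplify = solve-∀

rotation-form : ∀ T a d → det T ≡ 1ℤ → apply T (a , d) ≡ O → apply T O ≡ I →
                let α = LatticeAffine.a T ; β = LatticeAffine.b T in
                β * d ≡ -1ℤ - α * a × (∀ p → apply T p ≡ rotation α β a d p)
rotation-form record { a = α ; b = β ; c = γ ; d = δ ; e = ε ; f = ζ } a d det≡1 TL≡O TO≡I =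
  β·d , λ { (x , y) → cong₂ _,_ (cong (λ ε → α * x + β * y + ε) ε≡1) (second-row x y) }
  where
  open ≡-Reasoning
  ε≡1 : ε ≡ 1ℤ
  ε≡1 = trans (sym (translation-part α β ε)) (cong proj₁ TO≡I)
  ζ≡0 : ζ ≡ 0ℤ
  ζ≡0 = trans (sym (translation-part γ δ ζ)) (cong proj₂ TO≡I)
  first : α * a + β * d ≡ -1ℤ
  first = trans (sym (add-sub (α * a + β * d) ε)) (cong₂ _-_ (cong proj₁ TL≡O) ε≡1)
  second : γ * a + δ * d ≡ 0ℤ
  second = trans (sym (add-sub (γ * a + δ * d) ζ)) (cong₂ _-_ (cong proj₂ TL≡O) ζ≡0)
  γ≡d : γ ≡ d
  γ≡d = proj₁ (cramer {α} {β} {γ} {δ} det≡1 first second)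
  δ≡-a : δ ≡ - a
  δ≡-a = proj₂ (cramer {α} {β} {γ} {δ} det≡1 first second)
  β·d : β * d ≡ -1ℤ - α * a
  β·d = trans (isolate (α * a) (β * d)) (cong (_- α * a) first)
    where
    isolate : ∀ u v → v ≡ u + v - u
    isolate = solve-∀
  second-row : ∀ x y → γ * x + δ * y + ζ ≡ d * x - a * y
  second-row x y = begin
    γ * x + δ * y + ζ    ≡⟨ cong₂ (λ c ζ → c * x + δ * y + ζ) γ≡d ζ≡0 ⟩
    d * x + δ * y + 0ℤ   ≡⟨ cong (λ δ → d * x + δ * y + 0ℤ) δ≡-a ⟩
    d * x + - a * y + 0ℤ ≡⟨ simplify d a x y ⟩
    d * x - a * y        ∎
    where
    simplify : ∀ d a x y → d * x + - a * y + 0ℤ ≡ d * x - a * y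
    simplify = solve-∀

reflection-form : ∀ T a d → apply T O ≡ O → apply T I ≡ (a , d) → apply T (a , d) ≡ I →
                  ∃ λ β' → β' * d ≡ 1ℤ - a * a
reflection-form record { a = α ; b = β ; e = ε } a d TO≡O TI≡L TL≡I = β , (begin
  β * d                              ≡⟨ isolate α β ε a d ⟩
  (α * a + β * d + ε) - α * a - ε    ≡⟨ cong₂ (λ r α → r - α * a - ε) (cong proj₁ TL≡I) α≡a ⟩
  1ℤ - a * a - ε                     ≡⟨ cong (λ ε → 1ℤ - a * a - ε) ε≡0 ⟩
  1ℤ - a * a - 0ℤ                    ≡⟨ ℤₚ.+-identityʳ _ ⟩
  1ℤ - a * a                         ∎)
  where
  open ≡-Reasoning
  isolate : ∀ α β ε a d → β * d ≡ (α * a + β * d + ε) - α * a - ε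
  isolate = solve-∀
  ε≡0 : ε ≡ 0ℤ
  ε≡0 = trans (sym (translation-part α β ε)) (cong proj₁ TO≡O)
  α≡a : α ≡ a
  α≡a = begin
    α                          ≡⟨ isolate' α β ε ⟩
    (α * 1ℤ + β * 0ℤ + ε) - ε  ≡⟨ cong₂ _-_ (cong proj₁ TI≡L) ε≡0 ⟩
    a - 0ℤ                     ≡⟨ ℤₚ.+-identityʳ a ⟩
    a                          ∎
    where
    isolate' : ∀ α β ε → α ≡ (α * 1ℤ + β * 0ℤ + ε) - ε
    isolate' = solve-∀

rotation-O : ∀ α β a d → rotation α β a d O ≡ I
rotation-O α β a d = cong₂ _,_ (row₁ α β) (row₂ a d)
  where
  row₁ : ∀ α β → α * 0ℤ + β * 0ℤ + 1ℤ ≡ 1ℤ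
  row₁ = solve-∀
  row₂ : ∀ a d → d * 0ℤ - a * 0ℤ ≡ 0ℤ
  row₂ = solve-∀

rotation-I : ∀ α β a d → rotation α β a d I ≡ (α + 1ℤ , d)
rotation-I α β a d = cong₂ _,_ (row₁ α β) (row₂ a d)
  where
  row₁ : ∀ α β → α * 1ℤ + β * 0ℤ + 1ℤ ≡ α + 1ℤ
  row₁ = solve-∀
  row₂ : ∀ a d → d * 1ℤ - a * 0ℤ ≡ d
  row₂ = solve-∀

rotation²-O : ∀ α β a d → (rotation α β a d ^ 2) O ≡ (α + 1ℤ , d)
rotation²-O α β a d = trans (cong (rotation α β a d) (rotation-O α β a d)) (rotation-I α β a d)

height : Pt → ℤ
height = proj₂

-- Cayley–Hamilton for the linear part, which has trace α - a and determinant 1.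
height-recurrence : ∀ α β a d → β * d ≡ -1ℤ - α * a → ∀ p → let ρ = rotation α β a d in
  height (ρ (ρ (ρ p))) - height (ρ (ρ p)) ≡ (α - a) * (height (ρ (ρ p)) - height (ρ p)) - (height (ρ p) - height p)
height-recurrence α β a d β·d (x , y) = begin
  y₃ - y₂                                                          ≡⟨ expand α β a d x y ⟩
  (α - a) * (y₂ - y₁) - (y₁ - y) + (β * d + 1ℤ + α * a) * (y₁ - y) ≡⟨ cong (λ c → r + c * (y₁ - y)) vanishes ⟩
  (α - a) * (y₂ - y₁) - (y₁ - y) + 0ℤ * (y₁ - y)                   ≡⟨ drop r (y₁ - y) ⟩
  (α - a) * (y₂ - y₁) - (y₁ - y)                                   ∎
  where
  open ≡-Reasoning
  x₁ y₁ x₂ y₂ y₃ r : ℤ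
  x₁ = α * x + β * y + 1ℤ
  y₁ = d * x - a * y
  x₂ = α * x₁ + β * y₁ + 1ℤ
  y₂ = d * x₁ - a * y₁
  y₃ = d * x₂ - a * y₂
  r = (α - a) * (y₂ - y₁) - (y₁ - y)
  expand : ∀ α β a d x y → let x₁ = α * x + β * y + 1ℤ ; y₁ = d * x - a * y
                               x₂ = α * x₁ + β * y₁ + 1ℤ ; y₂ = d * x₁ - a * y₁ in
           (d * x₂ - a * y₂) - y₂ ≡ (α - a) * (y₂ - y₁) - (y₁ - y) + (β * d + 1ℤ + α * a) * (y₁ - y)
  expand = solve-∀
  vanishes : β * d + 1ℤ + α * a ≡ 0ℤ
  vanishes = trans (cong (λ b → b + 1ℤ + α * a) β·d) (cancel α a)
    where
    cancel : ∀ α a → -1ℤ - α * a + 1ℤ + α * a ≡ 0ℤ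
    cancel = solve-∀
  drop : ∀ r s → r + 0ℤ * s ≡ r
  drop = solve-∀

nonNeg-* : ∀ {x y} → 0ℤ ≤ x → 0ℤ ≤ y → 0ℤ ≤ x * y
nonNeg-* {+ m} {+ n} _ _ = subst (0ℤ ≤_) (ℤₚ.pos-* m n) (ℤ.+≤+ z≤n)

second-order-monotone : ∀ {t} (Y : ℕ → ℤ) → + 2 ≤ t → (∀ m → Y (2 ℕ.+ m) ≡ t * Y (1 ℕ.+ m) - Y m) →
                        0ℤ ≤ Y 0 → Y 0 ≤ Y 1 → ∀ m → 0ℤ ≤ Y m × Y m ≤ Y (suc m)
second-order-monotone Y t≥2 recurrence Y₀≥0 Y₀≤Y₁ zero = Y₀≥0 , Y₀≤Y₁
second-order-monotone {t} Y t≥2 recurrence Y₀≥0 Y₀≤Y₁ (suc m) =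
  let Yₘ≥0 , Yₘ≤Yₘ₊₁ = second-order-monotone Y t≥2 recurrence Y₀≥0 Y₀≤Y₁ m
      Yₘ₊₁≥0 = ℤₚ.≤-trans Yₘ≥0 Yₘ≤Yₘ₊₁
  in Yₘ₊₁≥0 , ℤₚ.0≤i-j⇒j≤i (subst (0ℤ ≤_) (sym (increment m))
       (ℤₚ.+-mono-≤ (nonNeg-* (ℤₚ.i≤j⇒0≤j-i t≥2) Yₘ₊₁≥0) (ℤₚ.i≤j⇒0≤j-i Yₘ≤Yₘ₊₁)))
  where
  increment : ∀ m → Y (2 ℕ.+ m) - Y (1 ℕ.+ m) ≡ (t - + 2) * Y (1 ℕ.+ m) + (Y (1 ℕ.+ m) - Y m)
  increment m = trans (cong (_- Y (1 ℕ.+ m)) (recurrence m)) (regroup t (Y (1 ℕ.+ m)) (Y m))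
    where
    regroup : ∀ t b c → t * b - c - b ≡ (t - + 2) * b + (b - c)
    regroup = solve-∀

-- For trace at least 2 the heights along the orbit of O increase from the third point on.
rotation-escapes : ∀ α β a d → β * d ≡ -1ℤ - α * a → 0ℤ < d → + 2 ≤ α - a →
                   ∀ k → (rotation α β a d ^ (2 ℕ.+ k)) O ≢ (a , d)
rotation-escapes α β a d β·d d>0 t≥2 zero ρ²O≡L = trace≱2 (subst (λ a → + 2 ≤ α - a) (sym α+1≡a) t≥2)
  where
  α+1≡a : α + 1ℤ ≡ a
  α+1≡a = cong proj₁ (trans (sym (rotation²-O α β a d)) ρ²O≡L)
  trace≱2 : ¬ (+ 2 ≤ α - (α + 1ℤ))
  trace≱2 = 2≰-1 ∘ subst (+ 2 ≤_) (minus α)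
    where
    minus : ∀ α → α - (α + 1ℤ) ≡ -1ℤ
    minus = solve-∀
    2≰-1 : ¬ (+ 2 ≤ -1ℤ)
    2≰-1 ()
rotation-escapes α β a d β·d d>0 t≥2 (suc k) eq = ℤₚ.<-irrefl (sym (cong height eq)) (grows k)
  where
  ρ : Pt → Pt
  ρ = rotation α β a d
  y : ℕ → ℤ
  y m = height ((ρ ^ m) O)
  Y : ℕ → ℤ
  Y m = y (suc m) - y m
  y₁≡0 : y 1 ≡ 0ℤ
  y₁≡0 = cong height (rotation-O α β a d)
  y₂≡d : y 2 ≡ d
  y₂≡d = cong height (rotation²-O α β a d)
  Y₀≡0 : Y 0 ≡ 0ℤ
  Y₀≡0 = cong (_- 0ℤ) y₁≡0
  Y₁≡d : Y 1 ≡ d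
  Y₁≡d = trans (cong₂ _-_ y₂≡d y₁≡0) (ℤₚ.+-identityʳ d)
  monotone : ∀ m → 0ℤ ≤ Y m × Y m ≤ Y (suc m)
  monotone = second-order-monotone Y t≥2 (λ m → height-recurrence α β a d β·d ((ρ ^ m) O))
    (ℤₚ.≤-reflexive (sym Y₀≡0)) (subst₂ _≤_ (sym Y₀≡0) (sym Y₁≡d) (ℤₚ.<⇒≤ d>0))
  step : ∀ m → y (suc m) ≡ Y m + y m
  step m = split (y (suc m)) (y m)
    where
    split : ∀ p q → p ≡ (p - q) + q
    split = solve-∀
  grows : ∀ k → d < y (3 ℕ.+ k)
  grows zero = subst (d <_) (sym (step 2)) (subst (λ z → d < Y 2 + z) (sym y₂≡d)
    (subst (_< Y 2 + d) (ℤₚ.+-identityˡ d) (ℤₚ.+-monoˡ-< d Y₂>0)))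
    where
    Y₂>0 : 0ℤ < Y 2
    Y₂>0 = ℤₚ.<-≤-trans d>0 (subst (_≤ Y 2) Y₁≡d (proj₂ (monotone 1)))
  grows (suc k) = subst (d <_) (sym (step (3 ℕ.+ k))) (subst (_< Y (3 ℕ.+ k) + y (3 ℕ.+ k)) (ℤₚ.+-identityˡ d)
    (ℤₚ.+-mono-≤-< (proj₁ (monotone (3 ℕ.+ k))) (grows k)))

-- The arithmetic constraints

trace-cases : ∀ α a → α + 1ℤ ≡ a ⊎ 0ℤ < α - a + 1ℤ → ¬ (+ 2 ≤ α - a) →
              α ≡ a - 1ℤ ⊎ α ≡ a ⊎ α ≡ a + 1ℤ
trace-cases α a (inj₁ α+1≡a) _ = inj₁ (trans (shift α) (cong (_- 1ℤ) α+1≡a))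
  where
  shift : ∀ α → α ≡ α + 1ℤ - 1ℤ
  shift = solve-∀
trace-cases α a (inj₂ t+1>0) t≱2 = inj₂ (by-trace (α - a) (split α a) t+1>0 t≱2)
  where
  split : ∀ α a → α ≡ a + (α - a)
  split = solve-∀
  by-trace : ∀ t → α ≡ a + t → 0ℤ < t + 1ℤ → ¬ (+ 2 ≤ t) → α ≡ a ⊎ α ≡ a + 1ℤ
  by-trace (+ 0) α≡a+t _ _ = inj₁ (trans α≡a+t (ℤₚ.+-identityʳ a))
  by-trace (+ 1) α≡a+t _ _ = inj₂ α≡a+t
  by-trace (+ suc (suc n)) _ _ t≱2 = ⊥-elim (t≱2 (ℤ.+≤+ (s≤s (s≤s z≤n))))
  by-trace -[1+ 0 ] _ (ℤ.+<+ ()) _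
  by-trace -[1+ suc n ] _ () _

-- (a , d , α , β) for the six polygons of the classification.
data Admissible : ℕ → ℕ → ℤ → ℤ → Set where
  triangle₁      : Admissible 0 1 -1ℤ -1ℤ
  triangle₂      : Admissible 2 3 1ℤ -1ℤ
  square₃        : Admissible 0 1 0ℤ -1ℤ
  parallelogram₄ : Admissible 1 2 1ℤ -1ℤ
  hexagon₅       : Admissible 0 1 1ℤ -1ℤ
  hexagon₆       : Admissible 1 3 (+ 2) -1ℤ

private
  divides-abs : ∀ {M d c} → M * + d ≡ c → d ∣ ∣ c ∣
  divides-abs {M} {d} eq = divides ∣ M ∣ (trans (cong ∣_∣ (sym eq)) (ℤₚ.abs-* M (+ d)))

  not-multiple : ∀ β c d → {False (d ∣? ∣ c ∣)} → β * + d ≢ c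
  not-multiple β c d {d∤c} eq = toWitnessFalse d∤c (divides-abs {β} {d} eq)

  pinned : ∀ {a α} β n → β * + suc n ≡ -1ℤ * + suc n → Admissible a (suc n) α -1ℤ → Admissible a (suc n) α β
  pinned β n β·d = subst (Admissible _ _ _) (sym (ℤₚ.*-cancelʳ-≡ β -1ℤ (+ suc n) β·d))

-- d divides (β' - β) d, which is 2 - a, 2 or 2 + a, and β' d = 1 - a² = (2 - a) (2 + a) - 3.
modulus-divides : ∀ {a d α β β'} → α ≡ + a - 1ℤ ⊎ α ≡ + a ⊎ α ≡ + a + 1ℤ →
                  β * + d ≡ -1ℤ - α * + a → β' * + d ≡ 1ℤ - + a * + a → (d ∣ 2) ⊎ (d ∣ 3)
modulus-divides {a} {d} {β = β} {β'} (inj₁ refl) β·d β'·d =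
  inj₂ (divides-abs {(β' - β) * (- + a - + 2) + β'} (trans (combination β β' (+ d) (- + a - + 2))
    (trans (cong₂ (λ u v → (v - u) * (- + a - + 2) + v) β·d β'·d) (three (+ a)))))
  where
  three : ∀ a → (1ℤ - a * a - (-1ℤ - (a - 1ℤ) * a)) * (- a - + 2) + (1ℤ - a * a) ≡ -[1+ 2 ]
  three = solve-∀
  combination : ∀ β β' D m → ((β' - β) * m + β') * D ≡ (β' * D - β * D) * m + β' * D
  combination = solve-∀
modulus-divides {a} {d} {β = β} {β'} (inj₂ (inj₁ refl)) β·d β'·d =
  inj₁ (divides-abs {β' - β} (trans (combination β β' (+ d))
    (trans (cong₂ (λ u v → v - u) β·d β'·d) (two (+ a)))))
  where
  two : ∀ a → 1ℤ - a * a - (-1ℤ - a * a) ≡ + 2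
  two = solve-∀
  combination : ∀ β β' D → (β' - β) * D ≡ β' * D - β * D
  combination = solve-∀
modulus-divides {a} {d} {β = β} {β'} (inj₂ (inj₂ refl)) β·d β'·d =
  inj₂ (divides-abs {(β' - β) * (+ a - + 2) + β'} (trans (combination β β' (+ d) (+ a - + 2))
    (trans (cong₂ (λ u v → (v - u) * (+ a - + 2) + v) β·d β'·d) (three (+ a)))))
  where
  three : ∀ a → (1ℤ - a * a - (-1ℤ - (a + 1ℤ) * a)) * (a - + 2) + (1ℤ - a * a) ≡ -[1+ 2 ]
  three = solve-∀
  combination : ∀ β β' D m → ((β' - β) * m + β') * D ≡ (β' * D - β * D) * m + β' * D
  combination = solve-∀

modulus≤3 : ∀ {d} → (d ∣ 2) ⊎ (d ∣ 3) → d ℕ.≤ 3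
modulus≤3 = [ (λ d∣2 → ℕₚ.≤-trans (∣⇒≤ d∣2) (ℕₚ.n≤1+n 2)) , ∣⇒≤ ]′

admissible-small : ∀ {a d α β β'} → a ℕ.< d → d ℕ.≤ 3 → α ≡ + a - 1ℤ ⊎ α ≡ + a ⊎ α ≡ + a + 1ℤ →
                   β * + d ≡ -1ℤ - α * + a → β' * + d ≡ 1ℤ - + a * + a → Admissible a d α β
admissible-small {0} {1} {β = β} _ _ (inj₁ refl)        β·d _ = pinned β 0 β·d triangle₁
admissible-small {0} {1} {β = β} _ _ (inj₂ (inj₁ refl)) β·d _ = pinned β 0 β·d square₃
admissible-small {0} {1} {β = β} _ _ (inj₂ (inj₂ refl)) β·d _ = pinned β 0 β·d hexagon₅
admissible-small {0} {2} {β' = β'} _ _ _ _ β'·d               = ⊥-elim (not-multiple β' _ 2 β'·d)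
admissible-small {1} {2} {β = β} _ _ (inj₁ refl)        β·d _ = ⊥-elim (not-multiple β _ 2 β·d)
admissible-small {1} {2} {β = β} _ _ (inj₂ (inj₁ refl)) β·d _ = pinned β 1 β·d parallelogram₄
admissible-small {1} {2} {β = β} _ _ (inj₂ (inj₂ refl)) β·d _ = ⊥-elim (not-multiple β _ 2 β·d)
admissible-small {0} {3} {β' = β'} _ _ _ _ β'·d               = ⊥-elim (not-multiple β' _ 3 β'·d)
admissible-small {1} {3} {β = β} _ _ (inj₁ refl)        β·d _ = ⊥-elim (not-multiple β _ 3 β·d)
admissible-small {1} {3} {β = β} _ _ (inj₂ (inj₁ refl)) β·d _ = ⊥-elim (not-multiple β _ 3 β·d)
admissible-small {1} {3} {β = β} _ _ (inj₂ (inj₂ refl)) β·d _ = pinned β 2 β·d hexagon₆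
admissible-small {2} {3} {β = β} _ _ (inj₁ refl)        β·d _ = pinned β 2 β·d triangle₂
admissible-small {2} {3} {β = β} _ _ (inj₂ (inj₁ refl)) β·d _ = ⊥-elim (not-multiple β _ 3 β·d)
admissible-small {2} {3} {β = β} _ _ (inj₂ (inj₂ refl)) β·d _ = ⊥-elim (not-multiple β _ 3 β·d)
admissible-small {suc _} {1} (s≤s ()) _ _ _ _
admissible-small {suc (suc _)} {2} (s≤s (s≤s ())) _ _ _ _
admissible-small {suc (suc (suc _))} {3} (s≤s (s≤s (s≤s ()))) _ _ _ _
admissible-small {_} {suc (suc (suc (suc _)))} _ (s≤s (s≤s (s≤s ()))) _ _ _

admissible : ∀ {a d α β β'} → a ℕ.< d → α ≡ + a - 1ℤ ⊎ α ≡ + a ⊎ α ≡ + a + 1ℤ →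
             β * + d ≡ -1ℤ - α * + a → β' * + d ≡ 1ℤ - + a * + a → Admissible a d α β
admissible {β = β} {β'} a<d trace β·d β'·d =
  admissible-small {β = β} {β'} a<d (modulus≤3 (modulus-divides {β = β} {β'} trace β·d β'·d)) trace β·d β'·d

-- Recognising the six polygons

Classified : ∀ {n} → (Fin n → Pt) → Set
Classified v = LatticeCongruent v triangle1 ⊎ LatticeCongruent v triangle2 ⊎ LatticeCongruent v square3
             ⊎ LatticeCongruent v parallelogram4 ⊎ LatticeCongruent v hexagon5 ⊎ LatticeCongruent v hexagon6

classified-trans : ∀ {m n} {u : Fin m → Pt} {v : Fin n → Pt} → LatticeCongruent u v → Classified v → Classified u
classified-trans {u = u} u≅v =
  Sum.map (congruent-trans {u = u} u≅v) (Sum.map (congruent-trans {u = u} u≅v) (Sum.map (congruent-trans {u = u} u≅v)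
    (Sum.map (congruent-trans {u = u} u≅v) (Sum.map (congruent-trans {u = u} u≅v) (congruent-trans {u = u} u≅v)))))

_≟ₚ_ : DecidableEquality Pt
_≟ₚ_ = ≡-dec ℤ._≟_ ℤ._≟_

mapsOnto? : ∀ T {m n} (u : Fin m → Pt) (w : Fin n → Pt) → Dec (MapsOnto T u w)
mapsOnto? T u w =
  all? (λ i → any? λ j → apply T (u i) ≟ₚ w j) ×-dec all? (λ j → any? λ i → apply T (u i) ≟ₚ w j)

orbit : (Pt → Pt) → Pt → ∀ n → Fin n → Pt
orbit f x n j = (f ^ toℕ j) x

closed? : (f : Pt → Pt) → ∀ {n} (w : Fin (suc n) → Pt) → Dec (∀ j → f (w j) ≡ w (next j))
closed? f w = all? λ j → f (w j) ≟ₚ w (next j)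

module _ (P : ConvexLatticePolygon) {f : Pt → Pt} {x : Pt}
         (vert-orbit : ∀ m → vert P ((next ^ m) zero) ≡ (f ^ m) x) where

  closed-orbit-congruent : ∀ {r} (w : Fin (suc r) → Pt) → w zero ≡ x → (∀ j → f (w j) ≡ w (next j)) →
                           LatticeCongruent (vert P) w
  closed-orbit-congruent w w₀≡x closed =
    idᴬ , (λ i → (next ^ toℕ i) zero , into i) , (λ j → (next ^ toℕ j) zero , onto j)
    where
    along : ∀ m → (f ^ m) x ≡ w ((next ^ m) zero)
    along zero = sym w₀≡x
    along (suc m) = trans (cong f (along m)) (closed ((next ^ m) zero))
    into : ∀ i → apply idᴬ (vert P i) ≡ w ((next ^ toℕ i) zero)
    into i = trans (apply-idᴬ (vert P i))
      (trans (cong (vert P) (sym (next^-toℕ-id i))) (trans (vert-orbit (toℕ i)) (along (toℕ i))))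
    onto : ∀ j → apply idᴬ (vert P ((next ^ toℕ j) zero)) ≡ w j
    onto j = trans (apply-idᴬ _) (trans (vert-orbit (toℕ j)) (trans (along (toℕ j)) (cong w (next^-toℕ-id j))))

  congruent-by : ∀ n (U : LatticeAffine) {m} (w : Fin m → Pt) →
                 {True (closed? f (orbit f x (suc n)))} → {True (mapsOnto? U (orbit f x (suc n)) w)} →
                 LatticeCongruent (vert P) w
  congruent-by n U w {closed} {maps} =
    congruent-trans (closed-orbit-congruent (orbit f x (suc n)) refl (toWitness closed)) (U , toWitness maps)

-- The orbit of O is carried onto hexagon5 and hexagon6 by U₅ and U₆.
U₅ U₆ : LatticeAffine
U₅ = record { a = 1ℤ ; b = -1ℤ ; c = 0ℤ ; d = 1ℤ ; e = 0ℤ ; f = -1ℤ ; unimodular = inj₁ refl }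
U₆ = record { a = 1ℤ ; b = 0ℤ ; c = -1ℤ ; d = 1ℤ ; e = -2ℤ ; f = -1ℤ ; unimodular = inj₁ refl }

admissible-classified : ∀ {P a d α β} → Admissible a d α β →
                        (∀ m → vert P ((next ^ m) zero) ≡ (rotation α β (+ a) (+ d) ^ m) O) → Classified (vert P)
admissible-classified {P} triangle₁ orb = inj₁ (congruent-by P orb 2 idᴬ triangle1)
admissible-classified {P} triangle₂ orb = inj₂ (inj₁ (congruent-by P orb 2 idᴬ triangle2))
admissible-classified {P} square₃ orb = inj₂ (inj₂ (inj₁ (congruent-by P orb 3 idᴬ square3)))
admissible-classified {P} parallelogram₄ orb = inj₂ (inj₂ (inj₂ (inj₁ (congruent-by P orb 3 idᴬ parallelogram4))))
admissible-classified {P} hexagon₅ orb = inj₂ (inj₂ (inj₂ (inj₂ (inj₁ (congruent-by P orb 5 U₅ hexagon5)))))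
admissible-classified {P} hexagon₆ orb = inj₂ (inj₂ (inj₂ (inj₂ (inj₂ (congruent-by P orb 5 U₆ hexagon6)))))

module _ (P : ConvexLatticePolygon) (regular : LatticeRegular P) (normal : NormalForm P) where
  open NormalForm normal

  private
    ℓ : Fin (3 ℕ.+ k P)
    ℓ = fromℕ (2 ℕ.+ k P)
    L : Pt
    L = (+ a , + d)
    next-ℓ : next ℓ ≡ zero
    next-ℓ = next-fromℕ (2 ℕ.+ k P)
    d>0 : 0ℤ < + d
    d>0 = ℤ.+<+ (ℕₚ.≤-trans (s≤s z≤n) a<d)

    in-coordinates : ∀ T {i j p q} → vert P i ≡ p → vert P j ≡ q → apply T (vert P i) ≡ vert P j → apply T p ≡ q
    in-coordinates T Vi≡p Vj≡q = subst₂ (λ p q → apply T p ≡ q) Vi≡p Vj≡q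

    rotation-flags : Σ LatticeAffine λ T → Symmetry P T
                     × apply T (vert P ℓ) ≡ vert P zero × apply T (vert P (next ℓ)) ≡ vert P (suc zero)
    rotation-flags = regular (ℓ , false) (zero , false)
    σ : LatticeAffine
    σ = proj₁ rotation-flags
    σ-symmetry : Symmetry P σ
    σ-symmetry = proj₁ (proj₂ rotation-flags)
    σℓ : apply σ (vert P ℓ) ≡ vert P zero
    σℓ = proj₁ (proj₂ (proj₂ rotation-flags))
    σnext-ℓ : apply σ (vert P (next ℓ)) ≡ vert P (suc zero)
    σnext-ℓ = proj₂ (proj₂ (proj₂ rotation-flags))
    σ-det : det σ ≡ 1ℤ
    σ-det = preserving⇒det≡1 {P} {σ} σ-symmetry {ℓ} {zero} σℓ σnext-ℓ
    σ0 : apply σ (vert P zero) ≡ vert P (suc zero)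
    σ0 = subst (λ i → apply σ (vert P i) ≡ vert P (suc zero)) next-ℓ σnext-ℓ

    α β : ℤ
    α = LatticeAffine.a σ
    β = LatticeAffine.b σ
    ρ : Pt → Pt
    ρ = rotation α β (+ a) (+ d)
    σ-form : β * + d ≡ -1ℤ - α * + a × (∀ p → apply σ p ≡ ρ p)
    σ-form = rotation-form σ (+ a) (+ d) σ-det
      (in-coordinates σ vert-last vert-zero σℓ) (in-coordinates σ vert-zero vert-one σ0)

    vert-orbit : ∀ m → vert P ((next ^ m) zero) ≡ (ρ ^ m) O
    vert-orbit m = trans (rotation-orbit {P} {σ} σ-symmetry σ-det σ0 m)
      (trans (cong (apply σ ^ m) vert-zero) (^-cong (proj₂ σ-form) m O))

    reflection-flags : Σ LatticeAffine λ T → Symmetry P T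
                       × apply T (vert P zero) ≡ vert P (next ℓ) × apply T (vert P (suc zero)) ≡ vert P ℓ
    reflection-flags = regular (zero , false) (ℓ , true)
    τ : LatticeAffine
    τ = proj₁ reflection-flags
    τ-symmetry : Symmetry P τ
    τ-symmetry = proj₁ (proj₂ reflection-flags)
    τ0 : apply τ (vert P zero) ≡ vert P (next ℓ)
    τ0 = proj₁ (proj₂ (proj₂ reflection-flags))
    τ1 : apply τ (vert P (suc zero)) ≡ vert P ℓ
    τ1 = proj₂ (proj₂ (proj₂ reflection-flags))
    τ-det : det τ ≡ -1ℤ
    τ-det = reversing⇒det≡-1 {P} {τ} τ-symmetry {zero} {ℓ} τ0 τ1
    τ-fixes-0 : apply τ (vert P zero) ≡ vert P zero
    τ-fixes-0 = trans τ0 (cong (vert P) next-ℓ)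
    τℓ : apply τ (vert P ℓ) ≡ vert P (suc zero)
    τℓ = symmetry-prev {P} {τ} τ-symmetry τ-det {ℓ} {zero}
      (subst (λ i → apply τ (vert P i) ≡ vert P zero) (sym next-ℓ) τ-fixes-0)
    τ-form : ∃ λ β' → β' * + d ≡ 1ℤ - + a * + a
    τ-form = reflection-form τ (+ a) (+ d) (in-coordinates τ vert-zero vert-zero τ-fixes-0)
      (in-coordinates τ vert-one vert-last τ1) (in-coordinates τ vert-last vert-one τℓ)

    -- Unless L is ρ I = (α + 1 , d), it lies to the left of the edge from I to ρ I.
    trace-lower : α + 1ℤ ≡ + a ⊎ 0ℤ < α - + a + 1ℤ
    trace-lower = by-decision (α + 1ℤ ℤ.≟ + a)
      where
      vert-two : vert P ((next ^ 2) zero) ≡ (α + 1ℤ , + d)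
      vert-two = trans (vert-orbit 2) (rotation²-O α β (+ a) (+ d))
      signed-area : ∀ α a d → (α + 1ℤ - 1ℤ) * (d - 0ℤ) - (d - 0ℤ) * (a - 1ℤ) ≡ (α - a + 1ℤ) * d
      signed-area = solve-∀
      by-decision : Dec (α + 1ℤ ≡ + a) → α + 1ℤ ≡ + a ⊎ 0ℤ < α - + a + 1ℤ
      by-decision (yes α+1≡a) = inj₁ α+1≡a
      by-decision (no α+1≢a) = inj₂ (positive-factorʳ d (subst (0ℤ <_) (signed-area α (+ a) (+ d))
        (subst₂ (λ p q → 0ℤ < orient p q L) vert-one vert-two
          (subst (λ r → 0ℤ < orient (vert P (suc zero)) (vert P ((next ^ 2) zero)) r) vert-last
            (edge-isEdge P (suc zero) ℓ ℓ≢1 ℓ≢2)))))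
        where
        ℓ≢1 : vert P ℓ ≢ vert P (suc zero)
        ℓ≢1 eq with trans (sym (cong proj₂ vert-last)) (trans (cong proj₂ eq) (cong proj₂ vert-one)) | d>0
        ... | refl | ℤ.+<+ ()
        ℓ≢2 : vert P ℓ ≢ vert P ((next ^ 2) zero)
        ℓ≢2 eq = α+1≢a (sym (cong proj₁ (trans (sym vert-last) (trans eq vert-two))))

    trace-upper : ¬ (+ 2 ≤ α - + a)
    trace-upper t≥2 = rotation-escapes α β (+ a) (+ d) (proj₁ σ-form) d>0 t≥2 (k P)
      (trans (sym (vert-orbit (2 ℕ.+ k P)))
        (trans (cong (vert P) (next^-toℕ (2 ℕ.+ k P) ℓ (toℕ-fromℕ (2 ℕ.+ k P)))) vert-last))

  normal-classified : Classified (vert P)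
  normal-classified = admissible-classified {P} (admissible {β = β} {proj₁ τ-form} a<d
    (trace-cases α (+ a) trace-lower trace-upper) (proj₁ σ-form) (proj₂ τ-form)) vert-orbit

proposition1 : (P : ConvexLatticePolygon) → Elementary P → LatticeRegular P →
    LatticeCongruent (vert P) triangle1
    ⊎ LatticeCongruent (vert P) triangle2
    ⊎ LatticeCongruent (vert P) square3
    ⊎ LatticeCongruent (vert P) parallelogram4
    ⊎ LatticeCongruent (vert P) hexagon5
    ⊎ LatticeCongruent (vert P) hexagon6
proposition1 P elementary regular =
  let P' , P≅P' , regular' , normal = normal-form P regular (elementary⇒primitive P elementary regular)
  in classified-trans P≅P' (normal-classified P' regular' normal)
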